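{- Let $G=(V,E)$ be a graph, $C$ a minimum vertex cover of $G$, and $(L^C,X^C,R^C)$ a partition of $C$ into three parts. Let $(T,\{X_i\})$ be a nice tree decomposition of $G$ and consider the set of nodes of $T$ whose trace on $C$ is $(L^C,X^C,R^C)$. If $L^C\neq\emptyset$, then these nodes induce a directed subpath of $T$, going from a lower node $imin$ up to an upper node $imax$ (an ancestor of $imin$).
   Context: A tree decomposition of $G$ is a pair $(T,\{X_i\}_{i\in I})$ with $T$ a tree and $X_i\subseteq V$ (bags) such that every vertex lies in some bag, every edge has both endpoints in some bag, and for each vertex $v$ the nodes whose bags contain $v$ induce a connected subtree of $T$. A nice tree decomposition is a rooted tree decomposition in which every node is of one of four types: a leaf node $i$ with $|X_i|=1$; an introduce node $i$ with a unique child $j$ and $X_i=X_j\cup\{u\}$ for some $u\notin X_j$; a forget node $i$ with a unique child $j$ and $X_i=X_j\setminus\{u\}$ for some $u\in X_j$; or a join node $i$ with exactly two children $j,k$ and $X_i=X_j=X_k$. For a node $i$ of a rooted tree decomposition, let $V_i$ be the union of the bags in the subtree rooted at $i$, $L_i=V_i\setminus X_i$, $R_i=V\setminus V_i$; the trace of $i$ on $C$ is $(L_i\cap C,X_i\cap C,R_i\cap C)$. -}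

module Defs where

open import Data.Nat using (ℕ; _≤_)
open import Data.Fin using (Fin)
open import Data.Fin.Subset using (Subset; _∈_; _∉_; _∪_; _-_; ⁅_⁆; ∣_∣)
open import Data.Product using (Σ; ∃; _×_)
open import Data.Sum using (_⊎_)
open import Relation.Nullary using (¬_)
open import Relation.Binary.PropositionalEquality using (_≡_)
open import Relation.Binary.Construct.Closure.ReflexiveTransitive using (Star)
open import Function.Bundles using (_⇔_)

record Graph (n : ℕ) : Set₁ where
  field
    Adj     : Fin n → Fin n → Set
    symm    : ∀ {u v} → Adj u v → Adj v u
    irrefl  : ∀ {u} → ¬ Adj u u

open Graph public

IsVertexCover : ∀ {n} → Graph n → Subset n → Set
IsVertexCover G C = ∀ u v → Adj G u v → (u ∈ C ⊎ v ∈ C)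

IsMinVertexCover : ∀ {n} → Graph n → Subset n → Set
IsMinVertexCover G C =
  IsVertexCover G C × (∀ C′ → IsVertexCover G C′ → ∣ C ∣ ≤ ∣ C′ ∣)

-- Rooted trees whose nodes satisfy the "nice" shape conditions.
-- NiceTree n X : a rooted tree whose root bag is X.

data NiceTree (n : ℕ) : Subset n → Set where
  leaf      : ∀ {X} (v : Fin n) → X ≡ ⁅ v ⁆ → NiceTree n X
  introduce : ∀ {X Y} (u : Fin n) → u ∉ Y → X ≡ Y ∪ ⁅ u ⁆ →
              NiceTree n Y → NiceTree n X
  forget    : ∀ {X Y} (u : Fin n) → u ∈ Y → X ≡ Y - u →
              NiceTree n Y → NiceTree n X
  join      : ∀ {X} → NiceTree n X → NiceTree n X → NiceTree n X

data Node {n : ℕ} : ∀ {X} → NiceTree n X → Set where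
  here   : ∀ {X} {t : NiceTree n X} → Node t
  inIntro : ∀ {X Y u p e} {t : NiceTree n Y} → Node t → Node (introduce {X = X} u p e t)
  inForget : ∀ {X Y u p e} {t : NiceTree n Y} → Node t → Node (forget {X = X} u p e t)
  inLeft  : ∀ {X} {t s : NiceTree n X} → Node t → Node (join t s)
  inRight : ∀ {X} {t s : NiceTree n X} → Node s → Node (join t s)

bag : ∀ {n X} {t : NiceTree n X} → Node t → Subset n
bag {X = X} here = X
bag (inIntro i) = bag i
bag (inForget i) = bag i
bag (inLeft i) = bag i
bag (inRight i) = bag i

data ChildOf {n : ℕ} : ∀ {X} {t : NiceTree n X} → Node t → Node t → Set where
  c-intro  : ∀ {X Y u p e} {t : NiceTree n Y} →
             ChildOf {t = introduce {X = X} u p e t} (inIntro here) here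
  c-forget : ∀ {X Y u p e} {t : NiceTree n Y} →
             ChildOf {t = forget {X = X} u p e t} (inForget here) here
  c-left   : ∀ {X} {t s : NiceTree n X} → ChildOf {t = join t s} (inLeft here) here
  c-right  : ∀ {X} {t s : NiceTree n X} → ChildOf {t = join t s} (inRight here) here
  s-intro  : ∀ {X Y u p e} {t : NiceTree n Y} {i j : Node t} → ChildOf i j →
             ChildOf {t = introduce {X = X} u p e t} (inIntro i) (inIntro j)
  s-forget : ∀ {X Y u p e} {t : NiceTree n Y} {i j : Node t} → ChildOf i j →
             ChildOf {t = forget {X = X} u p e t} (inForget i) (inForget j)
  s-left   : ∀ {X} {t s : NiceTree n X} {i j : Node t} → ChildOf i j →
             ChildOf {t = join t s} (inLeft i) (inLeft j)
  s-right  : ∀ {X} {t s : NiceTree n X} {i j : Node s} → ChildOf i j →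
             ChildOf {t = join t s} (inRight i) (inRight j)

Descendant : ∀ {n X} {t : NiceTree n X} → Node t → Node t → Set
Descendant = Star ChildOf

TreeAdj : ∀ {n X} {t : NiceTree n X} → Node t → Node t → Set
TreeAdj i j = ChildOf i j ⊎ ChildOf j i

ConnectedIn : ∀ {n X} (t : NiceTree n X) → (Node t → Set) → Set
ConnectedIn t S = ∀ i j → S i → S j →
  Star (λ a b → S a × S b × TreeAdj a b) i j

IsTreeDecomposition : ∀ {n X} → Graph n → NiceTree n X → Set
IsTreeDecomposition {n} G t =
  (∀ (v : Fin n) → ∃ λ (i : Node t) → v ∈ bag i) ×
  (∀ u v → Adj G u v → ∃ λ (i : Node t) → u ∈ bag i × v ∈ bag i) ×
  (∀ (v : Fin n) → ConnectedIn t (λ i → v ∈ bag i))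

InV : ∀ {n X} {t : NiceTree n X} → Node t → Fin n → Set
InV i v = ∃ λ j → Descendant j i × v ∈ bag j

InL : ∀ {n X} {t : NiceTree n X} → Node t → Fin n → Set
InL i v = InV i v × v ∉ bag i

InR : ∀ {n X} {t : NiceTree n X} → Node t → Fin n → Set
InR i v = ¬ InV i v

HasTrace : ∀ {n X} {t : NiceTree n X} → Subset n → Node t →
           Subset n → Subset n → Subset n → Set
HasTrace {n} C i LC XC RC = ∀ (v : Fin n) →
  ((v ∈ LC) ⇔ (v ∈ C × InL i v)) ×
  ((v ∈ XC) ⇔ (v ∈ C × v ∈ bag i)) ×
  ((v ∈ RC) ⇔ (v ∈ C × InR i v))

IsPartition3 : ∀ {n} → Subset n → Subset n → Subset n → Subset n → Set
IsPartition3 {n} C LC XC RC = ∀ (v : Fin n) →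
  ((v ∈ C) ⇔ (v ∈ LC ⊎ v ∈ XC ⊎ v ∈ RC)) ×
  ¬ (v ∈ LC × v ∈ XC) × ¬ (v ∈ LC × v ∈ RC) × ¬ (v ∈ XC × v ∈ RC)

module Submission where

-- Let S be the set of nodes whose trace on C is (LC, XC, RC).  S is convex in the ancestor order: between two nodes of S,
-- the part of C already forgotten (L) only grows, the part not yet introduced (R)
-- only shrinks, and a vertex in both bags stays in every bag in between by
-- connectivity; since L, X, R are disjoint this pins down the trace.  And S is a
-- chain: a vertex v ∈ LC lies in L_i for every i ∈ S, so every bag containing v
-- lies in the subtree of every i ∈ S, hence any two nodes of S have a common
-- descendant and are comparable.  A finite nonempty convex chain is the path
-- between its least and greatest element.

open import Defs
open import Data.Nat using (ℕ)
open import Data.Fin using (Fin)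
open import Data.Fin.Subset using (Subset; _∈_)
open import Data.Fin.Subset.Properties using (_∈?_)
import Data.Fin.Properties as Fin
open import Data.Product using (∃; _×_; _,_; proj₁; proj₂)
import Data.Product as Product
open import Data.Sum using (_⊎_; inj₁; inj₂)
import Data.Sum as Sum
open import Data.Empty using (⊥-elim)
open import Data.List using (List; []; _∷_; map; _++_)
open import Data.List.Relation.Unary.Any using (here; there; any?; satisfied)
open import Data.List.Membership.Propositional using (lose) renaming (_∈_ to _∈ₗ_)
open import Data.List.Membership.Propositional.Properties using (∈-map⁺; ∈-++⁺ˡ; ∈-++⁺ʳ)
open import Relation.Nullary using (¬_; Dec; yes; no)
open import Relation.Nullary.Decidable using (map′; _×-dec_; _→-dec_; ¬?)
open import Relation.Unary using (Decidable)
open import Relation.Binary.PropositionalEquality using (_≡_; refl; cong; subst)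
open import Relation.Binary.Construct.Closure.ReflexiveTransitive using (Star; ε; _◅_; _◅◅_; gmap)
open import Function using (_∘_; flip)
open import Function.Bundles using (_⇔_; mk⇔; Equivalence)

_⇔-dec_ : {A B : Set} → Dec A → Dec B → Dec (A ⇔ B)
a? ⇔-dec b? = map′ (λ (f , g) → mk⇔ f g) (λ e → Equivalence.to e , Equivalence.from e)
                   ((a? →-dec b?) ×-dec (b? →-dec a?))

module Least {A : Set} {P : A → Set} (P? : Decidable P) {_≤_ : A → A → Set}
    (≤-refl : ∀ {a} → a ≤ a) (≤-trans : ∀ {a b c} → a ≤ b → b ≤ c → a ≤ c)
    (≤-total : ∀ {a b} → P a → P b → a ≤ b ⊎ b ≤ a) where

  least : (xs : List A) → ∃ P → ∃ λ m → P m × (∀ {k} → k ∈ₗ xs → P k → m ≤ k)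
  least [] (m , pm) = m , pm , λ ()
  least (x ∷ xs) m₀ with least xs m₀ | P? x
  ... | m , pm , m≤ | no ¬px = m , pm , λ { (here refl) px → ⊥-elim (¬px px) ; (there k∈) → m≤ k∈ }
  ... | m , pm , m≤ | yes px with ≤-total px pm
  ...   | inj₁ x≤m = x , px , λ { (here refl) _ → ≤-refl ; (there k∈) pk → ≤-trans x≤m (m≤ k∈ pk) }
  ...   | inj₂ m≤x = m , pm , λ { (here refl) _ → m≤x ; (there k∈) → m≤ k∈ }

infix 4 _≼_

-- i ≼ j : node i lies in the subtree rooted at j.
data _≼_ {n : ℕ} : ∀ {X} {t : NiceTree n X} → Node t → Node t → Set where
  ≼-here    : ∀ {X} {t : NiceTree n X} {i : Node t} → i ≼ here
  ≼-intro   : ∀ {X Y u p e} {t : NiceTree n Y} {i j : Node t} → i ≼ j →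
              inIntro {X = X} {u = u} {p = p} {e = e} i ≼ inIntro j
  ≼-forget  : ∀ {X Y u p e} {t : NiceTree n Y} {i j : Node t} → i ≼ j →
              inForget {X = X} {u = u} {p = p} {e = e} i ≼ inForget j
  ≼-left    : ∀ {X} {t s : NiceTree n X} {i j : Node t} → i ≼ j →
              inLeft {s = s} i ≼ inLeft j
  ≼-right   : ∀ {X} {t s : NiceTree n X} {i j : Node s} → i ≼ j →
              inRight {t = t} i ≼ inRight j

private
  variable
    n : ℕ
    X : Subset n
    t : NiceTree n X

≼-refl : {i : Node t} → i ≼ i
≼-refl {i = here}       = ≼-here
≼-refl {i = inIntro i}  = ≼-intro ≼-refl
≼-refl {i = inForget i} = ≼-forget ≼-refl
≼-refl {i = inLeft i}   = ≼-left ≼-refl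
≼-refl {i = inRight i}  = ≼-right ≼-refl

≼-trans : {i j k : Node t} → i ≼ j → j ≼ k → i ≼ k
≼-trans _            ≼-here       = ≼-here
≼-trans (≼-intro p)  (≼-intro q)  = ≼-intro (≼-trans p q)
≼-trans (≼-forget p) (≼-forget q) = ≼-forget (≼-trans p q)
≼-trans (≼-left p)   (≼-left q)   = ≼-left (≼-trans p q)
≼-trans (≼-right p)  (≼-right q)  = ≼-right (≼-trans p q)

≼-antisym : {i j : Node t} → i ≼ j → j ≼ i → i ≡ j
≼-antisym ≼-here       ≼-here       = refl
≼-antisym (≼-intro p)  (≼-intro q)  = cong inIntro (≼-antisym p q)
≼-antisym (≼-forget p) (≼-forget q) = cong inForget (≼-antisym p q)
≼-antisym (≼-left p)   (≼-left q)   = cong inLeft (≼-antisym p q)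
≼-antisym (≼-right p)  (≼-right q)  = cong inRight (≼-antisym p q)

ancestors-comparable : {a i j : Node t} → a ≼ i → a ≼ j → i ≼ j ⊎ j ≼ i
ancestors-comparable ≼-here       _            = inj₂ ≼-here
ancestors-comparable _            ≼-here       = inj₁ ≼-here
ancestors-comparable (≼-intro p)  (≼-intro q)  = Sum.map ≼-intro ≼-intro (ancestors-comparable p q)
ancestors-comparable (≼-forget p) (≼-forget q) = Sum.map ≼-forget ≼-forget (ancestors-comparable p q)
ancestors-comparable (≼-left p)   (≼-left q)   = Sum.map ≼-left ≼-left (ancestors-comparable p q)
ancestors-comparable (≼-right p)  (≼-right q)  = Sum.map ≼-right ≼-right (ancestors-comparable p q)

root≼⇒≡ : {i : Node t} → here ≼ i → here ≡ i
root≼⇒≡ ≼-here = refl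

child⇒≼ : {i j : Node t} → ChildOf i j → i ≼ j
child⇒≼ c-intro      = ≼-here
child⇒≼ c-forget     = ≼-here
child⇒≼ c-left       = ≼-here
child⇒≼ c-right      = ≼-here
child⇒≼ (s-intro c)  = ≼-intro (child⇒≼ c)
child⇒≼ (s-forget c) = ≼-forget (child⇒≼ c)
child⇒≼ (s-left c)   = ≼-left (child⇒≼ c)
child⇒≼ (s-right c)  = ≼-right (child⇒≼ c)

child≼⇒parent≼ : {a b i : Node t} → ChildOf a b → a ≼ i → b ≼ i ⊎ a ≡ i
child≼⇒parent≼ _            ≼-here       = inj₁ ≼-here
child≼⇒parent≼ c-intro      (≼-intro p)  = inj₂ (cong inIntro (root≼⇒≡ p))
child≼⇒parent≼ c-forget     (≼-forget p) = inj₂ (cong inForget (root≼⇒≡ p))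
child≼⇒parent≼ c-left       (≼-left p)   = inj₂ (cong inLeft (root≼⇒≡ p))
child≼⇒parent≼ c-right      (≼-right p)  = inj₂ (cong inRight (root≼⇒≡ p))
child≼⇒parent≼ (s-intro c)  (≼-intro p)  = Sum.map ≼-intro (cong inIntro) (child≼⇒parent≼ c p)
child≼⇒parent≼ (s-forget c) (≼-forget p) = Sum.map ≼-forget (cong inForget) (child≼⇒parent≼ c p)
child≼⇒parent≼ (s-left c)   (≼-left p)   = Sum.map ≼-left (cong inLeft) (child≼⇒parent≼ c p)
child≼⇒parent≼ (s-right c)  (≼-right p)  = Sum.map ≼-right (cong inRight) (child≼⇒parent≼ c p)

avoiding-path-stays-below : {S : Node t → Set} {i a b : Node t} → ¬ S i →
  Star (λ a b → S a × S b × TreeAdj a b) a b → a ≼ i → b ≼ i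
avoiding-path-stays-below ¬Si ε a≼i = a≼i
avoiding-path-stays-below ¬Si ((Sa , _ , inj₁ c) ◅ path) a≼i with child≼⇒parent≼ c a≼i
... | inj₁ b≼i = avoiding-path-stays-below ¬Si path b≼i
... | inj₂ refl = ⊥-elim (¬Si Sa)
avoiding-path-stays-below ¬Si ((_ , _ , inj₂ c) ◅ path) a≼i =
  avoiding-path-stays-below ¬Si path (≼-trans (child⇒≼ c) a≼i)

Descendant⇒≼ : {i j : Node t} → Descendant i j → i ≼ j
Descendant⇒≼ ε       = ≼-refl
Descendant⇒≼ (c ◅ d) = ≼-trans (child⇒≼ c) (Descendant⇒≼ d)

descendant-root : (i : Node t) → Descendant i here
descendant-root here         = ε
descendant-root (inIntro i)  = gmap inIntro s-intro (descendant-root i) ◅◅ (c-intro ◅ ε)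
descendant-root (inForget i) = gmap inForget s-forget (descendant-root i) ◅◅ (c-forget ◅ ε)
descendant-root (inLeft i)   = gmap inLeft s-left (descendant-root i) ◅◅ (c-left ◅ ε)
descendant-root (inRight i)  = gmap inRight s-right (descendant-root i) ◅◅ (c-right ◅ ε)

≼⇒Descendant : {i j : Node t} → i ≼ j → Descendant i j
≼⇒Descendant {i = i} ≼-here = descendant-root i
≼⇒Descendant (≼-intro p)    = gmap inIntro s-intro (≼⇒Descendant p)
≼⇒Descendant (≼-forget p)   = gmap inForget s-forget (≼⇒Descendant p)
≼⇒Descendant (≼-left p)     = gmap inLeft s-left (≼⇒Descendant p)
≼⇒Descendant (≼-right p)    = gmap inRight s-right (≼⇒Descendant p)

_≼?_ : (i j : Node t) → Dec (i ≼ j)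
i          ≼? here       = yes ≼-here
here       ≼? inIntro j  = no λ ()
here       ≼? inForget j = no λ ()
here       ≼? inLeft j   = no λ ()
here       ≼? inRight j  = no λ ()
inIntro i  ≼? inIntro j  = map′ ≼-intro (λ { (≼-intro p) → p }) (i ≼? j)
inForget i ≼? inForget j = map′ ≼-forget (λ { (≼-forget p) → p }) (i ≼? j)
inLeft i   ≼? inLeft j   = map′ ≼-left (λ { (≼-left p) → p }) (i ≼? j)
inLeft i   ≼? inRight j  = no λ ()
inRight i  ≼? inLeft j   = no λ ()
inRight i  ≼? inRight j  = map′ ≼-right (λ { (≼-right p) → p }) (i ≼? j)

nodes            : (t : NiceTree n X) → List (Node t)
nodes-below-root : (t : NiceTree n X) → List (Node t)
nodes t = here ∷ nodes-below-root t
nodes-below-root (leaf _ _)          = []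
nodes-below-root (introduce _ _ _ t) = map inIntro (nodes t)
nodes-below-root (forget _ _ _ t)    = map inForget (nodes t)
nodes-below-root (join t s)          = map inLeft (nodes t) ++ map inRight (nodes s)

∈-nodes : (i : Node t) → i ∈ₗ nodes t
∈-nodes                here         = here refl
∈-nodes                (inIntro i)  = there (∈-map⁺ inIntro (∈-nodes i))
∈-nodes                (inForget i) = there (∈-map⁺ inForget (∈-nodes i))
∈-nodes                (inLeft i)   = there (∈-++⁺ˡ (∈-map⁺ inLeft (∈-nodes i)))
∈-nodes {t = join t _} (inRight i)  = there (∈-++⁺ʳ (map inLeft (nodes t)) (∈-map⁺ inRight (∈-nodes i)))

any-node? : {P : Node t → Set} → Decidable P → Dec (∃ P)
any-node? {t = t} P? = map′ satisfied (λ (i , Pi) → lose (∈-nodes i) Pi) (any? P? (nodes t))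

module _ {S : Node t → Set} (S? : Decidable S)
         (comparable : ∀ {i j} → S i → S j → i ≼ j ⊎ j ≼ i)
         (convex : ∀ {i j k} → S i → S j → i ≼ k → k ≼ j → S k) where

  open Least S? ≼-refl ≼-trans comparable
    using () renaming (least to lowest)
  open Least S? ≼-refl (flip ≼-trans) (λ Sa Sb → Sum.swap (comparable Sa Sb))
    using () renaming (least to highest)

  convex-chain-is-interval : ∃ S →
    ∃ λ imin → ∃ λ imax → imin ≼ imax × (∀ i → S i ⇔ (imin ≼ i × i ≼ imax))
  convex-chain-is-interval i₀ with lowest (nodes _) i₀ | highest (nodes _) i₀
  ... | imin , Simin , imin≼ | imax , Simax , ≼imax =
    imin , imax , imin≼ (∈-nodes imax) Simax ,
    λ i → mk⇔ (λ Si → imin≼ (∈-nodes i) Si , ≼imax (∈-nodes i) Si)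
              (λ (imin≼i , i≼imax) → convex Simin Simax imin≼i i≼imax)

InV-mono : {i k : Node t} {v : Fin n} → i ≼ k → InV i v → InV k v
InV-mono i≼k (j , j≼i , v∈j) = j , ≼⇒Descendant (≼-trans (Descendant⇒≼ j≼i) i≼k) , v∈j

InR-antimono : {i k : Node t} {v : Fin n} → i ≼ k → InR k v → InR i v
InR-antimono i≼k ¬Vk = ¬Vk ∘ InV-mono i≼k

InV? : (i : Node t) (v : Fin n) → Dec (InV i v)
InV? i v = map′ (λ (j , j≼i , v∈j) → j , ≼⇒Descendant j≼i , v∈j)
                (λ (j , j≼i , v∈j) → j , Descendant⇒≼ j≼i , v∈j)
                (any-node? λ j → (j ≼? i) ×-dec (v ∈? bag j))

trace? : (C LC XC RC : Subset n) (i : Node t) → Dec (HasTrace C i LC XC RC)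
trace? C LC XC RC i = Fin.all? λ v →
  ((v ∈? LC) ⇔-dec ((v ∈? C) ×-dec (InV? i v ×-dec ¬? (v ∈? bag i)))) ×-dec
  ((v ∈? XC) ⇔-dec ((v ∈? C) ×-dec (v ∈? bag i))) ×-dec
  ((v ∈? RC) ⇔-dec ((v ∈? C) ×-dec ¬? (InV? i v)))

module _ {n : ℕ} {X : Subset n} {t : NiceTree n X}
         (connected : ∀ v → ConnectedIn t (λ i → v ∈ bag i)) where

  InL⇒bags-below : {i c : Node t} {v : Fin n} → InL i v → v ∈ bag c → c ≼ i
  InL⇒bags-below {v = v} ((a , a≼i , v∈a) , v∉i) v∈c =
    avoiding-path-stays-below v∉i (connected v _ _ v∈a v∈c) (Descendant⇒≼ a≼i)

  InL-mono : {i k : Node t} {v : Fin n} → i ≼ k → InL i v → InL k v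
  InL-mono {v = v} i≼k Li@(Vi , v∉i) = InV-mono i≼k Vi , λ v∈k →
    v∉i (subst (λ a → v ∈ bag a) (≼-antisym (InL⇒bags-below Li v∈k) i≼k) v∈k)

  bag-convex : {i j k : Node t} {v : Fin n} → v ∈ bag i → v ∈ bag j →
               i ≼ k → k ≼ j → v ∈ bag k
  bag-convex {k = k} {v} v∈i v∈j i≼k k≼j with v ∈? bag k
  ... | yes v∈k = v∈k
  ... | no v∉k with ≼-antisym (avoiding-path-stays-below v∉k (connected v _ _ v∈i v∈j) i≼k) k≼j
  ...   | refl = ⊥-elim (v∉k v∈j)

module _ {n : ℕ} {C LC XC RC : Subset n} (part : IsPartition3 C LC XC RC)
         {X : Subset n} {t : NiceTree n X} where

  private
    C⇒parts : {v : Fin n} → v ∈ C → v ∈ LC ⊎ v ∈ XC ⊎ v ∈ RC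
    C⇒parts {v} = Equivalence.to (proj₁ (part v))

    parts⇒C : {v : Fin n} → v ∈ LC ⊎ v ∈ XC ⊎ v ∈ RC → v ∈ C
    parts⇒C {v} = Equivalence.from (proj₁ (part v))

  -- Since L_k, X_k, R_k are disjoint, it suffices that each part of C lands in the right one.
  trace-from-inclusions : {k : Node t} →
    (∀ {v} → v ∈ LC → InL k v) → (∀ {v} → v ∈ XC → v ∈ bag k) → (∀ {v} → v ∈ RC → InR k v) →
    HasTrace C k LC XC RC
  trace-from-inclusions {k = k} L⊆ X⊆ R⊆ v =
    mk⇔ (λ l → parts⇒C (inj₁ l) , L⊆ l) from-L ,
    mk⇔ (λ x → parts⇒C (inj₂ (inj₁ x)) , X⊆ x) from-X ,
    mk⇔ (λ r → parts⇒C (inj₂ (inj₂ r)) , R⊆ r) from-R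
    where
    from-L : v ∈ C × InL k v → v ∈ LC
    from-L (c , Vk , v∉k) with C⇒parts c
    ... | inj₁ l        = l
    ... | inj₂ (inj₁ x) = ⊥-elim (v∉k (X⊆ x))
    ... | inj₂ (inj₂ r) = ⊥-elim (R⊆ r Vk)
    from-X : v ∈ C × v ∈ bag k → v ∈ XC
    from-X (c , v∈k) with C⇒parts c
    ... | inj₁ l        = ⊥-elim (proj₂ (L⊆ l) v∈k)
    ... | inj₂ (inj₁ x) = x
    ... | inj₂ (inj₂ r) = ⊥-elim (R⊆ r (k , ε , v∈k))
    from-R : v ∈ C × InR k v → v ∈ RC
    from-R (c , Rk) with C⇒parts c
    ... | inj₁ l        = ⊥-elim (Rk (proj₁ (L⊆ l)))
    ... | inj₂ (inj₁ x) = ⊥-elim (Rk (k , ε , X⊆ x))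
    ... | inj₂ (inj₂ r) = r

  module _ {i : Node t} (Ti : HasTrace C i LC XC RC) {v : Fin n} where

    trace-L : v ∈ LC → InL i v
    trace-L = proj₂ ∘ Equivalence.to (proj₁ (Ti v))

    trace-X : v ∈ XC → v ∈ bag i
    trace-X = proj₂ ∘ Equivalence.to (proj₁ (proj₂ (Ti v)))

    trace-R : v ∈ RC → InR i v
    trace-R = proj₂ ∘ Equivalence.to (proj₂ (proj₂ (Ti v)))

  module _ (connected : ∀ v → ConnectedIn t (λ i → v ∈ bag i)) where

    trace-convex : {i j k : Node t} →
      HasTrace C i LC XC RC → HasTrace C j LC XC RC → i ≼ k → k ≼ j → HasTrace C k LC XC RC
    trace-convex Ti Tj i≼k k≼j = trace-from-inclusions
      (InL-mono connected i≼k ∘ trace-L Ti)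
      (λ x → bag-convex connected (trace-X Ti x) (trace-X Tj x) i≼k k≼j)
      (InR-antimono k≼j ∘ trace-R Tj)

    trace-comparable : {v : Fin n} → v ∈ LC → {i j : Node t} →
      HasTrace C i LC XC RC → HasTrace C j LC XC RC → i ≼ j ⊎ j ≼ i
    trace-comparable l Ti Tj with trace-L Tj l
    ... | (c , c≼j , v∈c) , _ =
      ancestors-comparable (InL⇒bags-below connected (trace-L Ti l) v∈c) (Descendant⇒≼ c≼j)

lemma2 : ∀ {n : ℕ} (G : Graph n) (C LC XC RC : Subset n) →
    IsMinVertexCover G C →
    IsPartition3 C LC XC RC →
    ∀ {X : Subset n} (T : NiceTree n X) →
    IsTreeDecomposition G T →
    (∃ λ (v : Fin n) → v ∈ LC) →
    (∃ λ (i : Node T) → HasTrace C i LC XC RC) →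
    ∃ λ (imin : Node T) → ∃ λ (imax : Node T) →
    Descendant imin imax ×
    (∀ (i : Node T) →
    HasTrace C i LC XC RC ⇔ (Descendant imin i × Descendant i imax))
lemma2 G C LC XC RC _ part T (_ , _ , connected) (_ , v∈LC) i₀
  with convex-chain-is-interval (trace? C LC XC RC) (trace-comparable part connected v∈LC)
                                (trace-convex part connected) i₀
... | imin , imax , imin≼imax , interval =
  imin , imax , ≼⇒Descendant imin≼imax ,
  λ i → mk⇔ (Product.map ≼⇒Descendant ≼⇒Descendant ∘ Equivalence.to (interval i))
            (Equivalence.from (interval i) ∘ Product.map Descendant⇒≼ Descendant⇒≼)
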